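{- Let $\lambda$ be an $m$-partition of $dn$ and let $\bar\lambda=(\lambda_2,\lambda_3,\ldots)$ denote $\lambda$ with its first part removed (trailing zeros dropped). If $\bar\lambda\in\{(3,3),(3,1),(2,1),(1,1),(1)\}$, then $a_\lambda(d[n])=0$.
   Context: An $m$-partition of $N$ is a nonincreasing list of $m$ nonnegative integers summing to $N$. The plethysm coefficient $a_\lambda(d[n])$ is the coefficient of the Schur function $s_\lambda$ in $h_d[h_n]$, equivalently the multiplicity of the irreducible $\mathsf{GL}_m$-representation of highest weight $\lambda$ in $\mathrm{Sym}^d(\mathrm{Sym}^n\mathbb{C}^m)$. -}

module Defs where

open import Data.Nat using (ℕ; zero; suc; _+_; _*_; _∸_; _≥_; _<ᵇ_)
open import Data.Integer as ℤ using (ℤ; +_)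
open import Data.Nat.ListAction using (sum)
open import Data.List using (List; []; _∷_; map; concatMap; upTo; zipWith; length; reverse; applyUpTo; foldr)
open import Data.Vec using (Vec; toList)
open import Data.Bool using (Bool; true; false; if_then_else_)
open import Relation.Nullary.Decidable using (does)
open import Data.List.Relation.Unary.All using (All)
open import Data.List.Relation.Unary.Linked using (Linked)
open import Relation.Binary.PropositionalEquality using (_≡_)
open import Data.Product using (_×_)

IsPartition : ∀ {m} → ℕ → Vec ℕ m → Set
IsPartition N λ' = Linked _≥_ (toList λ') × (sum (toList λ') ≡ N)


dropTrailingZeros : List ℕ → List ℕ
dropTrailingZeros [] = []
dropTrailingZeros (x ∷ xs) with dropTrailingZeros xs
... | [] = if does (x Data.Nat.≟ 0) then [] else x ∷ []
... | y ∷ ys = x ∷ y ∷ ys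

bar : ∀ {m} → Vec ℕ m → List ℕ
bar λ' with toList λ'
... | [] = []
... | _ ∷ rest = dropTrailingZeros rest

-- exponent vectors of the monomials of degree n in m variables
-- (a basis of Sym^n ℂ^m, each listed once)
monomials : ℕ → ℕ → List (List ℕ)
monomials zero zero = [] ∷ []
monomials zero (suc n) = []
monomials (suc m) n = concatMap (λ k → map (k ∷_) (monomials m (n ∸ k))) (upTo (suc n))

isZeroVec : List ℤ → Bool
isZeroVec [] = true
isZeroVec (x ∷ xs) = if does (x ℤ.≟ + 0) then isZeroVec xs else false

scaleSub : ℕ → List ℕ → List ℤ → List ℤ
scaleSub k v α = zipWith (λ a x → a ℤ.- + (k * x)) α v

-- number of multisets of size d of elements of the list (distinct items)
-- whose exponent vectors sum to α
multisetCount : List (List ℕ) → ℕ → List ℤ → ℕ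
multisetCount [] zero α = if isZeroVec α then 1 else 0
multisetCount [] (suc d) α = 0
multisetCount (v ∷ vs) d α =
  sum (map (λ k → multisetCount vs (d ∸ k) (scaleSub k v α)) (upTo (suc d)))

-- coefficient of x^α in h_d[h_n](x₁,…,x_m)
-- (= dimension of the α-weight space of Sym^d(Sym^n ℂ^m));
-- α ∈ ℤ^m, zero if some entry is negative.
weightMult : (m d n : ℕ) → List ℤ → ℕ
weightMult m d n α = multisetCount (monomials m n) d α

-- Schur coefficient via the bialternant definition s_λ = a_{λ+δ}/a_δ
-- (Macdonald I.3): for a symmetric polynomial f = Σ c_μ s_μ in m variables,
-- c_λ = [x^{λ+δ}] (a_δ f) = Σ_{w ∈ S_m} sgn(w) [x^{λ+δ-w(δ)}] f.

insertions : {A : Set} → A → List A → List (List A)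
insertions x [] = (x ∷ []) ∷ []
insertions x (y ∷ ys) = (x ∷ y ∷ ys) ∷ map (y ∷_) (insertions x ys)

permutations : {A : Set} → List A → List (List A)
permutations [] = [] ∷ []
permutations (x ∷ xs) = concatMap (insertions x) (permutations xs)

delta : ℕ → List ℕ
delta m = reverse (upTo m)

-- number of pairs i<j with p_i < p_j; for p = w(δ) this is the number of
-- inversions of w
ascents : List ℕ → ℕ
ascents [] = 0
ascents (x ∷ xs) = sum (map (λ y → if x <ᵇ y then 1 else 0) xs) + ascents xs

parity : ℕ → ℤ
parity zero = + 1
parity (suc k) = ℤ.- parity k

-- a_λ(d[n]) in m variables: coefficient of s_λ in h_d[h_n](x₁,…,x_m)
plethysmCoeff : (m d n : ℕ) → Vec ℕ m → ℤ
plethysmCoeff m d n λ' =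
  foldr ℤ._+_ (+ 0)
    (map (λ p → parity (ascents p) ℤ.*
                 + weightMult m d n
                     (zipWith (λ a b → a ℤ.- + b)
                       (zipWith (λ l e → + (l + e)) (toList λ') (delta m)) p))
         (permutations (delta m)))

{-# OPTIONS --safe #-}

-- Stability under appending zero parts reduces every case to three rows λ = (a, b, c), where (b, c)
-- is λ̄, padded with a zero if needed. In the bialternant formula for a_λ(d[n]) every weight has
-- total degree dn, so its first coordinate is determined by the other two: deleting it turns the
-- weight multiplicity into the number of size-d multisets of monomials of degree ≤ n in two
-- variables with prescribed exponents, which no longer involves a. Those exponents sum to at most
-- b + c + 1 ≤ 2b + c = K, so monomials of degree > K never fit and at most K members of such a
-- multiset are non-constant: the coefficient depends on (d, n) only through (min(d, K), min(n, K)).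
-- As λ₁ ≥ b forces dn ≥ K, the finitely many remaining cases are decided by evaluation.

module Submission where

open import Defs
open import Data.Bool using (true; false; if_then_else_)
open import Data.Empty using (⊥-elim)
open import Data.Integer as ℤ using (ℤ; +_)
import Data.Integer.Properties as ℤ
open import Data.Integer.Tactic.RingSolver using (solve-∀)
open import Data.List
  using (List; []; _∷_; map; concat; concatMap; upTo; applyUpTo; zipWith; length; foldr; drop; replicate;
         reverse; _++_; _∷ʳ_)
import Data.List.Properties as List
open import Data.List.Relation.Binary.Permutation.Propositional as ↭ using (_↭_)
open import Data.List.Relation.Binary.Permutation.Propositional.Properties using (↭-length)
open import Data.List.Relation.Unary.All as All using (All; []; _∷_; all?)
import Data.List.Relation.Unary.All.Properties as All
open import Data.List.Relation.Unary.Any as Any using (Any; here; there)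
open import Data.List.Relation.Unary.Linked as Linked using (Linked)
open import Data.Nat
  using (ℕ; zero; suc; _+_; _*_; _∸_; _≤_; _<_; _≥_; z≤n; s≤s; _⊓_; _<ᵇ_; NonZero; >-nonZero; >-nonZero⁻¹)
open import Data.Nat.ListAction using (sum)
open import Data.Nat.ListAction.Properties using (sum-↭; sum-++)
open import Data.Nat.Properties
open import Data.Product as Product using (Σ; _×_; _,_; proj₁; proj₂)
open import Data.Sum using (_⊎_; inj₁; inj₂)
open import Data.Vec using (Vec; _∷_; toList)
import Data.Vec.Properties as Vec
open import Function using (_∘_; id)
open import Relation.Binary.PropositionalEquality
open import Relation.Nullary.Decidable using (Dec; yes; no; does; from-yes; _→-dec_)

private variable
  A : Set

length-∷ʳ : ∀ (xs : List A) y → length (xs ∷ʳ y) ≡ suc (length xs)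
length-∷ʳ xs y = trans (List.length-++ xs) (+-comm (length xs) 1)

zipWith-∷ʳ : ∀ {B C : Set} (f : A → B → C) xs ys x y → length xs ≡ length ys →
             zipWith f (xs ∷ʳ x) (ys ∷ʳ y) ≡ zipWith f xs ys ∷ʳ f x y
zipWith-∷ʳ f [] [] x y _ = refl
zipWith-∷ʳ f (a ∷ xs) (b ∷ ys) x y eq = cong (f a b ∷_) (zipWith-∷ʳ f xs ys x y (suc-injective eq))

sum-upTo-suc : ∀ (f : ℕ → ℕ) d → sum (map f (upTo (suc d))) ≡ f 0 + sum (map (f ∘ suc) (upTo d))
sum-upTo-suc f d = cong (λ xs → f 0 + sum xs) (trans (List.map-applyUpTo suc f d) (sym (List.map-upTo (f ∘ suc) d)))

sum-upTo-cong : ∀ {f g : ℕ → ℕ} d → (∀ {k} → k < d → f k ≡ g k) →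
                sum (map f (upTo d)) ≡ sum (map g (upTo d))
sum-upTo-cong d f≡g = cong sum (List.map-cong-local (All.applyUpTo⁺₁ id d f≡g))

sum-map-zero : ∀ (f : A → ℕ) → (∀ x → f x ≡ 0) → ∀ xs → sum (map f xs) ≡ 0
sum-map-zero f f≡0 [] = refl
sum-map-zero f f≡0 (x ∷ xs) rewrite f≡0 x = sum-map-zero f f≡0 xs

sum-upTo-head : ∀ (f : ℕ → ℕ) d → (∀ k → f (suc k) ≡ 0) → sum (map f (upTo (suc d))) ≡ f 0
sum-upTo-head f d f≡0 rewrite sum-upTo-suc f d | sum-map-zero (f ∘ suc) f≡0 (upTo d) = +-identityʳ (f 0)

sum-upTo-truncate : ∀ (f : ℕ → ℕ) {D d} → D ≤ d → (∀ {k} → D < k → f k ≡ 0) →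
                    sum (map f (upTo (suc d))) ≡ sum (map f (upTo (suc D)))
sum-upTo-truncate f {zero} {d} _ f≡0 = trans (sum-upTo-head f d (λ _ → f≡0 (s≤s z≤n))) (sym (+-identityʳ (f 0)))
sum-upTo-truncate f {suc D} {suc d} (s≤s D≤d) f≡0
  rewrite sum-upTo-suc f (suc d) | sum-upTo-suc f (suc D) =
  cong (_+_ (f 0)) (sum-upTo-truncate (f ∘ suc) D≤d (λ D<k → f≡0 (s≤s D<k)))

sum-replicate-zero : ∀ m → sum (replicate m 0) ≡ 0
sum-replicate-zero zero = refl
sum-replicate-zero (suc m) = sum-replicate-zero m

sum-++-replicate-zero : ∀ xs k → sum (xs ++ replicate k 0) ≡ sum xs
sum-++-replicate-zero xs k =
  trans (sum-++ xs (replicate k 0)) (trans (cong (_+_ (sum xs)) (sum-replicate-zero k)) (+-identityʳ (sum xs)))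

sumℤ : List ℤ → ℤ
sumℤ = foldr ℤ._+_ (+ 0)

sumℤ-++ : ∀ xs ys → sumℤ (xs ++ ys) ≡ sumℤ xs ℤ.+ sumℤ ys
sumℤ-++ [] ys = sym (ℤ.+-identityˡ (sumℤ ys))
sumℤ-++ (x ∷ xs) ys = trans (cong (ℤ._+_ x) (sumℤ-++ xs ys)) (sym (ℤ.+-assoc x (sumℤ xs) (sumℤ ys)))

sumℤ-concat : ∀ xss → sumℤ (concat xss) ≡ sumℤ (map sumℤ xss)
sumℤ-concat [] = refl
sumℤ-concat (xs ∷ xss) = trans (sumℤ-++ xs (concat xss)) (cong (ℤ._+_ (sumℤ xs)) (sumℤ-concat xss))

sumℤ-map-concatMap : ∀ {B : Set} (f : B → ℤ) (g : A → List B) xs →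
                     sumℤ (map f (concatMap g xs)) ≡ sumℤ (map (λ x → sumℤ (map f (g x))) xs)
sumℤ-map-concatMap f g xs =
  trans (cong sumℤ (List.map-concatMap f g xs))
        (trans (sumℤ-concat (map (map f ∘ g) xs)) (cong sumℤ (sym (List.map-∘ xs))))

sumℤ-map-zero : ∀ {f : A → ℤ} {xs} → All (λ x → f x ≡ + 0) xs → sumℤ (map f xs) ≡ + 0
sumℤ-map-zero [] = refl
sumℤ-map-zero (f≡0 ∷ fs≡0) rewrite f≡0 | sumℤ-map-zero fs≡0 = refl

insertions-↭ : ∀ (x : A) xs → All (_↭ x ∷ xs) (insertions x xs)
insertions-↭ x [] = ↭.refl ∷ []
insertions-↭ x (y ∷ ys) =
  ↭.refl ∷ All.map⁺ (All.map (λ s↭ → ↭.trans (↭.prep y s↭) (↭.swap y x ↭.refl)) (insertions-↭ x ys))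

permutations-↭ : ∀ (xs : List A) → All (_↭ xs) (permutations xs)
permutations-↭ [] = ↭.refl ∷ []
permutations-↭ (x ∷ xs) = All.concat⁺ (All.map⁺ (All.map
  (λ {q} q↭xs → All.map (λ s↭ → ↭.trans s↭ (↭.prep x q↭xs)) (insertions-↭ x q))
  (permutations-↭ xs)))

insertions-∷ʳ : ∀ (x : A) q y → insertions x (q ∷ʳ y) ≡ map (_∷ʳ y) (insertions x q) ∷ʳ ((q ∷ʳ y) ∷ʳ x)
insertions-∷ʳ x [] y = refl
insertions-∷ʳ x (w ∷ q) y = cong ((x ∷ w ∷ q ∷ʳ y) ∷_) (begin
  map (w ∷_) (insertions x (q ∷ʳ y))
    ≡⟨ cong (map (w ∷_)) (insertions-∷ʳ x q y) ⟩
  map (w ∷_) (map (_∷ʳ y) (insertions x q) ∷ʳ ((q ∷ʳ y) ∷ʳ x))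
    ≡⟨ List.map-++ (w ∷_) (map (_∷ʳ y) (insertions x q)) _ ⟩
  map (w ∷_) (map (_∷ʳ y) (insertions x q)) ∷ʳ ((w ∷ q ∷ʳ y) ∷ʳ x)
    ≡⟨ cong (_∷ʳ ((w ∷ q ∷ʳ y) ∷ʳ x)) (trans (sym (List.map-∘ (insertions x q)))
                                              (List.map-∘ (insertions x q))) ⟩
  map (_∷ʳ y) (map (w ∷_) (insertions x q)) ∷ʳ ((w ∷ q ∷ʳ y) ∷ʳ x) ∎)
  where open ≡-Reasoning

insertions-map : ∀ {B : Set} (f : A → B) x q → insertions (f x) (map f q) ≡ map (map f) (insertions x q)
insertions-map f x [] = refl
insertions-map f x (y ∷ q) = cong ((f x ∷ f y ∷ map f q) ∷_)
  (trans (cong (map (f y ∷_)) (insertions-map f x q))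
         (trans (sym (List.map-∘ (insertions x q))) (List.map-∘ (insertions x q))))

permutations-map : ∀ {B : Set} (f : A → B) xs → permutations (map f xs) ≡ map (map f) (permutations xs)
permutations-map f [] = refl
permutations-map f (x ∷ xs) = begin
  concatMap (insertions (f x)) (permutations (map f xs))
    ≡⟨ cong (concatMap (insertions (f x))) (permutations-map f xs) ⟩
  concatMap (insertions (f x)) (map (map f) (permutations xs))
    ≡⟨ List.concatMap-map (insertions (f x)) (map f) (permutations xs) ⟩
  concatMap (insertions (f x) ∘ map f) (permutations xs)
    ≡⟨ List.concatMap-cong (insertions-map f x) (permutations xs) ⟩
  concatMap (map (map f) ∘ insertions x) (permutations xs)
    ≡⟨ List.map-concatMap (map f) (insertions x) (permutations xs) ⟨
  map (map f) (concatMap (insertions x) (permutations xs)) ∎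
  where open ≡-Reasoning

sumℤ-permutations-∷ʳ : ∀ {A : Set} (F : List A → ℤ) xs {z} → All (_≢ z) xs →
  (∀ q y → length q ≡ length xs → y ≢ z → F (q ∷ʳ y) ≡ + 0) →
  sumℤ (map F (permutations (xs ∷ʳ z))) ≡ sumℤ (map (λ q → F (q ∷ʳ z)) (permutations xs))
sumℤ-permutations-∷ʳ F [] _ _ = refl
sumℤ-permutations-∷ʳ {A} F (x ∷ xs) {z} (x≢z ∷ xs≢z) F-vanishes = begin
  sumℤ (map F (concatMap (insertions x) (permutations (xs ∷ʳ z))))
    ≡⟨ sumℤ-map-concatMap F (insertions x) (permutations (xs ∷ʳ z)) ⟩
  sumℤ (map G (permutations (xs ∷ʳ z)))
    ≡⟨ sumℤ-permutations-∷ʳ G xs xs≢z G-vanishes ⟩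
  sumℤ (map (λ q → G (q ∷ʳ z)) (permutations xs))
    ≡⟨ cong sumℤ (List.map-cong-local (All.map (λ {q} q↭ → G-∷ʳ q z (↭-length q↭)) (permutations-↭ xs))) ⟩
  sumℤ (map (λ q → sumℤ (map (λ s → F (s ∷ʳ z)) (insertions x q))) (permutations xs))
    ≡⟨ sumℤ-map-concatMap (λ s → F (s ∷ʳ z)) (insertions x) (permutations xs) ⟨
  sumℤ (map (λ q → F (q ∷ʳ z)) (concatMap (insertions x) (permutations xs))) ∎
  where
  open ≡-Reasoning
  G : List A → ℤ
  G r = sumℤ (map F (insertions x r))
  G-∷ʳ : ∀ q y → length q ≡ length xs → G (q ∷ʳ y) ≡ sumℤ (map (λ s → F (s ∷ʳ y)) (insertions x q))
  G-∷ʳ q y lq = begin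
    sumℤ (map F (insertions x (q ∷ʳ y)))
      ≡⟨ cong (sumℤ ∘ map F) (insertions-∷ʳ x q y) ⟩
    sumℤ (map F (map (_∷ʳ y) (insertions x q) ∷ʳ ((q ∷ʳ y) ∷ʳ x)))
      ≡⟨ cong sumℤ (List.map-++ F (map (_∷ʳ y) (insertions x q)) _) ⟩
    sumℤ (map F (map (_∷ʳ y) (insertions x q)) ∷ʳ F ((q ∷ʳ y) ∷ʳ x))
      ≡⟨ sumℤ-++ (map F (map (_∷ʳ y) (insertions x q))) _ ⟩
    sumℤ (map F (map (_∷ʳ y) (insertions x q))) ℤ.+ (F ((q ∷ʳ y) ∷ʳ x) ℤ.+ + 0)
      ≡⟨ cong₂ ℤ._+_ (cong sumℤ (sym (List.map-∘ (insertions x q)))) (cong (λ t → t ℤ.+ + 0) last-vanishes) ⟩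
    sumℤ (map (λ s → F (s ∷ʳ y)) (insertions x q)) ℤ.+ + 0
      ≡⟨ ℤ.+-identityʳ _ ⟩
    sumℤ (map (λ s → F (s ∷ʳ y)) (insertions x q)) ∎
    where
    last-vanishes : F ((q ∷ʳ y) ∷ʳ x) ≡ + 0
    last-vanishes = F-vanishes (q ∷ʳ y) x (trans (length-∷ʳ q y) (cong suc lq)) x≢z
  G-vanishes : ∀ q y → length q ≡ length xs → y ≢ z → G (q ∷ʳ y) ≡ + 0
  G-vanishes q y lq y≢z = trans (G-∷ʳ q y lq)
    (sumℤ-map-zero (All.map (λ s↭ → F-vanishes _ y (trans (↭-length s↭) (cong suc lq)) y≢z) (insertions-↭ x q)))

-- Counting multisets of exponent vectors

HasNegative : List ℤ → Set
HasNegative = Any (ℤ._< + 0)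

OfLength : ℕ → List (List ℕ) → Set
OfLength m = All (λ v → length v ≡ m)

length-scaleSub : ∀ k v α → length v ≡ length α → length (scaleSub k v α) ≡ length α
length-scaleSub k [] [] _ = refl
length-scaleSub k (x ∷ v) (a ∷ α) eq = cong suc (length-scaleSub k v α (suc-injective eq))

OfLength-scaleSub : ∀ k v α {L} → length v ≡ length α → OfLength (length α) L →
                    OfLength (length (scaleSub k v α)) L
OfLength-scaleSub k v α {L} lv lL = subst (λ n → OfLength n L) (sym (length-scaleSub k v α lv)) lL

scaleSub-zero : ∀ {v α} → length v ≡ length α → scaleSub 0 v α ≡ α
scaleSub-zero {[]} {[]} _ = refl
scaleSub-zero {x ∷ v} {a ∷ α} eq = cong₂ _∷_ (ℤ.+-identityʳ a) (scaleSub-zero (suc-injective eq))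

scaleSub-HasNegative : ∀ k v α → length v ≡ length α → HasNegative α → HasNegative (scaleSub k v α)
scaleSub-HasNegative k (x ∷ v) (a ∷ α) eq (here a<0) = here (ℤ.≤-<-trans (ℤ.i-j≤i a (+ (k * x))) a<0)
scaleSub-HasNegative k (x ∷ v) (a ∷ α) eq (there neg) = there (scaleSub-HasNegative k v α (suc-injective eq) neg)

isZeroVec-HasNegative : ∀ {α} → HasNegative α → isZeroVec α ≡ false
isZeroVec-HasNegative {a ∷ α} neg with a ℤ.≟ + 0 | neg
... | yes refl | here 0<0 = ⊥-elim (ℤ.<-irrefl refl 0<0)
... | yes _    | there neg′ = isZeroVec-HasNegative neg′
... | no _     | _ = refl

multisetCount-HasNegative : ∀ L d α → OfLength (length α) L → HasNegative α → multisetCount L d α ≡ 0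
multisetCount-HasNegative [] zero α _ neg rewrite isZeroVec-HasNegative neg = refl
multisetCount-HasNegative [] (suc d) α _ _ = refl
multisetCount-HasNegative (v ∷ L) d α (lv ∷ lL) neg = sum-map-zero _ vanishes (upTo (suc d))
  where
  vanishes : ∀ k → multisetCount L (d ∸ k) (scaleSub k v α) ≡ 0
  vanishes k = multisetCount-HasNegative L (d ∸ k) (scaleSub k v α) (OfLength-scaleSub k v α lv lL)
                                         (scaleSub-HasNegative k v α lv neg)

Unusable : List ℤ → List ℕ → Set
Unusable α v = length v ≡ length α × (∀ k → HasNegative (scaleSub (suc k) v α))

multisetCount-unusable : ∀ {v L d α} → Unusable α v → OfLength (length α) L →
                         multisetCount (v ∷ L) d α ≡ multisetCount L d α
multisetCount-unusable {v} {L} {d} {α} (lv , neg) lL =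
  trans (sum-upTo-head _ d (λ k → multisetCount-HasNegative L (d ∸ suc k) _ (OfLength-scaleSub (suc k) v α lv lL) (neg k)))
        (cong (multisetCount L d) (scaleSub-zero lv))

multisetCount-++-unusable : ∀ {B L d α} → All (Unusable α) B → OfLength (length α) L →
                            multisetCount (B ++ L) d α ≡ multisetCount L d α
multisetCount-++-unusable [] lL = refl
multisetCount-++-unusable (v-unusable ∷ unusable) lL =
  trans (multisetCount-unusable v-unusable (All.++⁺ (All.map proj₁ unusable) lL))
        (multisetCount-++-unusable unusable lL)

-- Same value as multisetCount, but a branch is cut as soon as the remaining weight has a negative
-- entry; this is what makes the finite check at the end feasible.
multisetCountPruned : List (List ℕ) → ℕ → List ℤ → ℕ
multisetCountPruned [] d α = multisetCount [] d α
multisetCountPruned (v ∷ L) d α =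
  sum (map (λ k → if does (all? (+ 0 ℤ.≤?_) (scaleSub k v α))
                  then multisetCountPruned L (d ∸ k) (scaleSub k v α) else 0)
           (upTo (suc d)))

multisetCount≡multisetCountPruned : ∀ L d α → OfLength (length α) L →
                                    multisetCount L d α ≡ multisetCountPruned L d α
multisetCount≡multisetCountPruned [] d α _ = refl
multisetCount≡multisetCountPruned (v ∷ L) d α (lv ∷ lL) = sum-upTo-cong (suc d) (λ {k} _ → term k)
  where
  term : ∀ k → multisetCount L (d ∸ k) (scaleSub k v α)
             ≡ (if does (all? (+ 0 ℤ.≤?_) (scaleSub k v α)) then multisetCountPruned L (d ∸ k) (scaleSub k v α) else 0)
  term k with all? (+ 0 ℤ.≤?_) (scaleSub k v α)
  ... | yes _ = multisetCount≡multisetCountPruned L (d ∸ k) (scaleSub k v α) (OfLength-scaleSub k v α lv lL)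
  ... | no ¬nonnegative = multisetCount-HasNegative L (d ∸ k) (scaleSub k v α) (OfLength-scaleSub k v α lv lL)
                            (Any.map ℤ.≰⇒> (All.¬All⇒Any¬ (+ 0 ℤ.≤?_) _ ¬nonnegative))

sumℤ-scaleSub : ∀ k v β → length v ≡ length β → sumℤ (scaleSub k v β) ≡ sumℤ β ℤ.- + (k * sum v)
sumℤ-scaleSub k [] [] _ rewrite *-zeroʳ k = refl
sumℤ-scaleSub k (x ∷ v) (b ∷ β) eq
  rewrite sumℤ-scaleSub k v β (suc-injective eq) | *-distribˡ-+ k x (sum v) | ℤ.pos-+ (k * x) (k * sum v) =
  regroup b (sumℤ β) (+ (k * x)) (+ (k * sum v))
  where
  regroup : ∀ b B y Y → (b ℤ.- y) ℤ.+ (B ℤ.- Y) ≡ (b ℤ.+ B) ℤ.- (y ℤ.+ Y)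
  regroup = solve-∀

sumℤ-HasNegative : ∀ γ → sumℤ γ ℤ.< + 0 → HasNegative γ
sumℤ-HasNegative [] (ℤ.+<+ ())
sumℤ-HasNegative (x ∷ γ) sum<0 with x ℤ.<? + 0 | sumℤ γ ℤ.<? + 0
... | yes x<0 | _ = here x<0
... | no _ | yes γ<0 = there (sumℤ-HasNegative γ γ<0)
... | no x≮0 | no γ≮0 =
  ⊥-elim (ℤ.<-irrefl refl (ℤ.≤-<-trans (ℤ.+-mono-≤ (ℤ.≮⇒≥ x≮0) (ℤ.≮⇒≥ γ≮0)) sum<0))

HasNegative-scaleSub-beyond-total : ∀ k v β {D} → length v ≡ length β → sumℤ β ℤ.≤ + D → D < k * sum v →
                             HasNegative (scaleSub k v β)
HasNegative-scaleSub-beyond-total k v β {D} eq β≤D D<kv = sumℤ-HasNegative _ (begin-strict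
  sumℤ (scaleSub k v β)      ≡⟨ sumℤ-scaleSub k v β eq ⟩
  sumℤ β ℤ.- + (k * sum v)   ≤⟨ ℤ.+-monoˡ-≤ (ℤ.- + (k * sum v)) β≤D ⟩
  + D ℤ.- + (k * sum v)      <⟨ ℤ.+-monoˡ-< (ℤ.- + (k * sum v)) (ℤ.+<+ D<kv) ⟩
  + (k * sum v) ℤ.- + (k * sum v) ≡⟨ ℤ.+-inverseʳ (+ (k * sum v)) ⟩
  + 0                        ∎)
  where open ℤ.≤-Reasoning

isZeroVec⇒sumℤ≡0 : ∀ β → isZeroVec β ≡ true → sumℤ β ≡ + 0
isZeroVec⇒sumℤ≡0 [] _ = refl
isZeroVec⇒sumℤ≡0 (x ∷ β) eq with x ℤ.≟ + 0
isZeroVec⇒sumℤ≡0 (x ∷ β) eq | yes refl = trans (ℤ.+-identityˡ (sumℤ β)) (isZeroVec⇒sumℤ≡0 β eq)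

isZeroVec-∷ : ∀ X β → X ℤ.+ sumℤ β ≡ + 0 → isZeroVec (X ∷ β) ≡ isZeroVec β
isZeroVec-∷ X β eq with X ℤ.≟ + 0
... | yes _ = refl
... | no X≢0 with isZeroVec β in zero?
...   | false = refl
...   | true = ⊥-elim (X≢0 (trans (sym (ℤ.+-identityʳ X))
                               (trans (cong (ℤ._+_ X) (sym (isZeroVec⇒sumℤ≡0 β zero?))) eq)))

monomials-length : ∀ m n → OfLength m (monomials m n)
monomials-length zero zero = refl ∷ []
monomials-length zero (suc n) = []
monomials-length (suc m) n =
  All.concat⁺ (All.map⁺ (All.applyUpTo⁺₁ id (suc n) λ {k} _ →
    All.map⁺ (All.map (cong suc) (monomials-length m (n ∸ k)))))

monomials-degree : ∀ m n → All (λ v → sum v ≡ n) (monomials m n)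
monomials-degree zero zero = refl ∷ []
monomials-degree zero (suc n) = []
monomials-degree (suc m) n =
  All.concat⁺ (All.map⁺ (All.applyUpTo⁺₁ id (suc n) (λ {k} k≤n →
    All.map⁺ (All.map (λ deg → trans (cong (_+_ k) deg) (m+[n∸m]≡n (≤-pred k≤n))) (monomials-degree m (n ∸ k))))))

monomials-zero : ∀ m → monomials m 0 ≡ replicate m 0 ∷ []
monomials-zero zero = refl
monomials-zero (suc m) = cong (λ L → map (0 ∷_) L ++ []) (monomials-zero m)

monomialsUpTo : ℕ → ℕ → List (List ℕ)
monomialsUpTo m n = concatMap (λ k → monomials m (n ∸ k)) (upTo (suc n))

monomialsUpTo-suc : ∀ m n → monomialsUpTo m (suc n) ≡ monomials m (suc n) ++ monomialsUpTo m n
monomialsUpTo-suc m n = cong (monomials m (suc n) ++_)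
  (cong concat (trans (List.map-applyUpTo suc (λ k → monomials m (suc n ∸ k)) (suc n))
                      (sym (List.map-upTo (λ k → monomials m (n ∸ k)) (suc n)))))

monomialsUpTo-length : ∀ m n → OfLength m (monomialsUpTo m n)
monomialsUpTo-length m n = All.concat⁺ (All.map⁺ (All.applyUpTo⁺₁ id (suc n) (λ {k} _ → monomials-length m (n ∸ k))))

map-drop-monomials : ∀ m n → map (drop 1) (monomials (suc m) n) ≡ monomialsUpTo m n
map-drop-monomials m n =
  trans (List.map-concatMap (drop 1) (λ k → map (k ∷_) (monomials m (n ∸ k))) (upTo (suc n)))
        (List.concatMap-cong (λ k → trans (sym (List.map-∘ (monomials m (n ∸ k)))) (List.map-id (monomials m (n ∸ k))))
                             (upTo (suc n)))

-- The first coordinate of a weight is redundant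

sumℤ-after-removal : ∀ X Z k s {d j n} → j ≤ d → k + s ≡ n → X ℤ.+ Z ≡ + (d * n) →
                     (X ℤ.- + (j * k)) ℤ.+ (Z ℤ.- + (j * s)) ≡ + ((d ∸ j) * n)
sumℤ-after-removal X Z k s {d} {j} {n} j≤d k+s≡n X+Z≡dn = begin
  (X ℤ.- + (j * k)) ℤ.+ (Z ℤ.- + (j * s)) ≡⟨ regroup X Z (+ (j * k)) (+ (j * s)) ⟩
  (X ℤ.+ Z) ℤ.- (+ (j * k) ℤ.+ + (j * s)) ≡⟨ cong₂ ℤ._-_ X+Z≡dn (sym (ℤ.pos-+ (j * k) (j * s))) ⟩
  + (d * n) ℤ.- + (j * k + j * s)          ≡⟨ cong (λ t → + (d * n) ℤ.- + t) (trans (sym (*-distribˡ-+ j k s))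
                                                                                  (cong (j *_) k+s≡n)) ⟩
  + (d * n) ℤ.- + (j * n)                  ≡⟨ ℤ.m-n≡m⊖n (d * n) (j * n) ⟩
  (d * n) ℤ.⊖ (j * n)                      ≡⟨ ℤ.⊖-≥ (*-monoˡ-≤ n j≤d) ⟩
  + (d * n ∸ j * n)                        ≡⟨ cong +_ (sym (*-distribʳ-∸ n d j)) ⟩
  + ((d ∸ j) * n)                          ∎
  where
  open ≡-Reasoning
  regroup : ∀ X Z y Y → (X ℤ.- y) ℤ.+ (Z ℤ.- Y) ≡ (X ℤ.+ Z) ℤ.- (y ℤ.+ Y)
  regroup = solve-∀

multisetCount-dropFirst : ∀ n L d X β → OfLength (suc (length β)) L → All (λ v → sum v ≡ n) L →
                          X ℤ.+ sumℤ β ≡ + (d * n) → multisetCount L d (X ∷ β) ≡ multisetCount (map (drop 1) L) d β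
multisetCount-dropFirst n [] zero X β _ _ eq = cong (λ b → if b then 1 else 0) (isZeroVec-∷ X β eq)
multisetCount-dropFirst n [] (suc d) X β _ _ _ = refl
multisetCount-dropFirst n ((k ∷ t) ∷ L) d X β (lv ∷ lL) (deg ∷ degs) eq = sum-upTo-cong (suc d) λ {j} j≤d →
  multisetCount-dropFirst n L (d ∸ j) (X ℤ.- + (j * k)) (scaleSub j t β)
    (subst (λ l → OfLength (suc l) L) (sym (length-scaleSub j t β lt)) lL) degs
    (trans (cong (ℤ._+_ (X ℤ.- + (j * k))) (sumℤ-scaleSub j t β lt))
           (sumℤ-after-removal X (sumℤ β) k (sum t) (≤-pred j≤d) deg eq))
  where
  lt : length t ≡ length β
  lt = suc-injective lv

weightMult-suc : ∀ m d n w → length w ≡ suc m → sumℤ w ≡ + (d * n) →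
                 weightMult (suc m) d n w ≡ multisetCount (monomialsUpTo m n) d (drop 1 w)
weightMult-suc m d n (X ∷ β) lw eq =
  trans (multisetCount-dropFirst n (monomials (suc m) n) d X β lengths (monomials-degree (suc m) n) eq)
        (cong (λ L → multisetCount L d β) (map-drop-monomials m n))
  where
  lengths : OfLength (suc (length β)) (monomials (suc m) n)
  lengths rewrite suc-injective lw = monomials-length (suc m) n

-- Truncation in n and d

multisetCount-monomialsUpTo-+ : ∀ m D k d β → length β ≡ m → sumℤ β ℤ.≤ + D →
                                multisetCount (monomialsUpTo m (k + D)) d β ≡ multisetCount (monomialsUpTo m D) d β
multisetCount-monomialsUpTo-+ m D zero d β lβ β≤D = refl
multisetCount-monomialsUpTo-+ m D (suc k) d β lβ β≤D = begin
  multisetCount (monomialsUpTo m (suc k + D)) d β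
    ≡⟨ cong (λ L → multisetCount L d β) (monomialsUpTo-suc m (k + D)) ⟩
  multisetCount (monomials m (suc k + D) ++ monomialsUpTo m (k + D)) d β
    ≡⟨ multisetCount-++-unusable unusable (subst (λ l → OfLength l _) (sym lβ) (monomialsUpTo-length m (k + D))) ⟩
  multisetCount (monomialsUpTo m (k + D)) d β
    ≡⟨ multisetCount-monomialsUpTo-+ m D k d β lβ β≤D ⟩
  multisetCount (monomialsUpTo m D) d β ∎
  where
  open ≡-Reasoning
  D<degree : ∀ j → D < suc j * suc (k + D)
  D<degree j = <-≤-trans (s≤s (m≤n+m D k)) (m≤n*m (suc (k + D)) (suc j))
  unusable : All (Unusable β) (monomials m (suc k + D))
  unusable = All.map (λ {v} (lv , deg) → trans lv (sym lβ) , λ j →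
                        HasNegative-scaleSub-beyond-total (suc j) v β (trans lv (sym lβ)) β≤D
                          (subst (λ s → D < suc j * s) (sym deg) (D<degree j)))
                     (All.zip (monomials-length m (suc k + D) , monomials-degree m (suc k + D)))

Saturating : ℕ → List (List ℕ) → Set
Saturating m L = ∀ β {D d} → length β ≡ m → sumℤ β ℤ.≤ + D → D ≤ d →
                 multisetCount L d β ≡ multisetCount L D β

scaleSub-degree-zero : ∀ k v β → sum v ≡ 0 → length v ≡ length β → scaleSub k v β ≡ β
scaleSub-degree-zero k [] [] _ _ = refl
scaleSub-degree-zero k (x ∷ v) (b ∷ β) deg eq rewrite m+n≡0⇒m≡0 x deg | *-zeroʳ k =
  cong₂ _∷_ (ℤ.+-identityʳ b) (scaleSub-degree-zero k v β (m+n≡0⇒n≡0 x deg) (suc-injective eq))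

sum-multisetCount-[] : ∀ d β → sum (map (λ k → multisetCount [] (d ∸ k) β) (upTo (suc d))) ≡ multisetCount [] 0 β
sum-multisetCount-[] zero β = +-identityʳ _
sum-multisetCount-[] (suc d) β =
  trans (sum-upTo-suc (λ k → multisetCount [] (suc d ∸ k) β) (suc d)) (sum-multisetCount-[] d β)

multisetCount-degree-zero : ∀ v d β → sum v ≡ 0 → length v ≡ length β →
                            multisetCount (v ∷ []) d β ≡ multisetCount [] 0 β
multisetCount-degree-zero v d β deg eq =
  trans (sum-upTo-cong (suc d) (λ {k} _ → cong (multisetCount [] (d ∸ k)) (scaleSub-degree-zero k v β deg eq)))
        (sum-multisetCount-[] d β)

Saturating-degree-zero : ∀ {m v} → sum v ≡ 0 → length v ≡ m → Saturating m (v ∷ [])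
Saturating-degree-zero {v = v} deg lv β {D} {d} lβ _ _ =
  trans (multisetCount-degree-zero v d β deg (trans lv (sym lβ)))
        (sym (multisetCount-degree-zero v D β deg (trans lv (sym lβ))))

Saturating-∷ : ∀ {m v L} → length v ≡ m → 1 ≤ sum v → OfLength m L → Saturating m L → Saturating m (v ∷ L)
Saturating-∷ {m} {v} {L} lv deg lL sat β {D} {d} lβ β≤D D≤d =
  trans (sum-upTo-truncate (term d) D≤d vanishes)
        (sum-upTo-cong (suc D) λ {k} k≤D →
           sat (scaleSub k v β) (trans (length-scaleSub k v β lvβ) lβ) (bound (≤-pred k≤D)) (∸-monoˡ-≤ k D≤d))
  where
  lvβ : length v ≡ length β
  lvβ = trans lv (sym lβ)
  k≤k*deg : ∀ k → k ≤ k * sum v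
  k≤k*deg k = m≤m*n k (sum v) {{>-nonZero deg}}
  term : ℕ → ℕ → ℕ
  term e k = multisetCount L (e ∸ k) (scaleSub k v β)
  vanishes : ∀ {k} → D < k → term d k ≡ 0
  vanishes {k} D<k = multisetCount-HasNegative L (d ∸ k) (scaleSub k v β)
    (OfLength-scaleSub k v β lvβ (subst (λ l → OfLength l L) (sym lβ) lL))
    (HasNegative-scaleSub-beyond-total k v β lvβ β≤D (<-≤-trans D<k (k≤k*deg k)))
  bound : ∀ {k} → k ≤ D → sumℤ (scaleSub k v β) ℤ.≤ + (D ∸ k)
  bound {k} k≤D = begin
    sumℤ (scaleSub k v β)      ≡⟨ sumℤ-scaleSub k v β lvβ ⟩
    sumℤ β ℤ.- + (k * sum v)   ≤⟨ ℤ.+-monoˡ-≤ (ℤ.- + (k * sum v)) β≤D ⟩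
    + D ℤ.- + (k * sum v)      ≤⟨ ℤ.+-monoʳ-≤ (+ D) (ℤ.neg-mono-≤ (ℤ.+≤+ (k≤k*deg k))) ⟩
    + D ℤ.- + k                ≡⟨ ℤ.m-n≡m⊖n D k ⟩
    D ℤ.⊖ k                    ≡⟨ ℤ.⊖-≥ k≤D ⟩
    + (D ∸ k)                  ∎
    where open ℤ.≤-Reasoning

Saturating-++ : ∀ {m B L} → All (λ v → length v ≡ m × 1 ≤ sum v) B → OfLength m L → Saturating m L →
                Saturating m (B ++ L)
Saturating-++ [] lL sat = sat
Saturating-++ ((lv , deg) ∷ B) lL sat = Saturating-∷ lv deg (All.++⁺ (All.map proj₁ B) lL) (Saturating-++ B lL sat)

Saturating-monomialsUpTo : ∀ m n → Saturating m (monomialsUpTo m n)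
Saturating-monomialsUpTo m zero rewrite monomials-zero m =
  Saturating-degree-zero (sum-replicate-zero m) (List.length-replicate m)
Saturating-monomialsUpTo m (suc n) rewrite monomialsUpTo-suc m n =
  Saturating-++ (All.map (λ (lv , deg) → lv , subst (1 ≤_) (sym deg) (s≤s z≤n))
                         (All.zip (monomials-length m (suc n) , monomials-degree m (suc n))))
                (monomialsUpTo-length m n) (Saturating-monomialsUpTo m n)

multisetCount-monomialsUpTo-⊓ : ∀ m n d D β → length β ≡ m → sumℤ β ℤ.≤ + D →
  multisetCount (monomialsUpTo m n) d β ≡ multisetCount (monomialsUpTo m (n ⊓ D)) (d ⊓ D) β
multisetCount-monomialsUpTo-⊓ m n d D β lβ β≤D = trans truncate-n truncate-d
  where
  truncate-n : multisetCount (monomialsUpTo m n) d β ≡ multisetCount (monomialsUpTo m (n ⊓ D)) d β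
  truncate-n with ≤-total n D
  ... | inj₁ n≤D rewrite m≤n⇒m⊓n≡m n≤D = refl
  ... | inj₂ D≤n rewrite m≥n⇒m⊓n≡n D≤n =
    trans (cong (λ k → multisetCount (monomialsUpTo m k) d β) (sym (m∸n+n≡m D≤n)))
          (multisetCount-monomialsUpTo-+ m D (n ∸ D) d β lβ β≤D)
  truncate-d : multisetCount (monomialsUpTo m (n ⊓ D)) d β ≡ multisetCount (monomialsUpTo m (n ⊓ D)) (d ⊓ D) β
  truncate-d with ≤-total d D
  ... | inj₁ d≤D rewrite m≤n⇒m⊓n≡m d≤D = refl
  ... | inj₂ D≤d rewrite m≥n⇒m⊓n≡n D≤d = Saturating-monomialsUpTo m (n ⊓ D) β lβ β≤D D≤d

weight : List ℕ → List ℕ → List ℕ → List ℤ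
weight L δ p = zipWith (λ a b → a ℤ.- + b) (zipWith (λ l e → + (l + e)) L δ) p

sign : List ℕ → ℤ
sign p = parity (ascents p)

alternantSum : (List ℤ → ℕ) → List ℕ → List ℕ → ℤ
alternantSum f L δ = sumℤ (map (λ p → sign p ℤ.* + f (weight L δ p)) (permutations δ))

alternantSum-cong : ∀ {f g : List ℤ → ℕ} L δ → (∀ {p} → p ↭ δ → f (weight L δ p) ≡ g (weight L δ p)) →
                    alternantSum f L δ ≡ alternantSum g L δ
alternantSum-cong L δ f≡g =
  cong sumℤ (List.map-cong-local
    (All.map (λ {p} p↭δ → cong (λ c → sign p ℤ.* + c) (f≡g p↭δ)) (permutations-↭ δ)))

length-weight : ∀ L δ p → length L ≡ length δ → length δ ≡ length p → length (weight L δ p) ≡ length p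
length-weight [] [] [] _ _ = refl
length-weight (l ∷ L) (e ∷ δ) (x ∷ p) eq eq′ = cong suc (length-weight L δ p (suc-injective eq) (suc-injective eq′))

sumℤ-weight : ∀ L δ p → length L ≡ length δ → length δ ≡ length p →
              sumℤ (weight L δ p) ≡ + (sum L + sum δ) ℤ.- + sum p
sumℤ-weight [] [] [] _ _ = refl
sumℤ-weight (l ∷ L) (e ∷ δ) (x ∷ p) eq eq′
  rewrite sumℤ-weight L δ p (suc-injective eq) (suc-injective eq′)
        | ℤ.pos-+ (l + sum L) (e + sum δ) | ℤ.pos-+ l e | ℤ.pos-+ l (sum L) | ℤ.pos-+ e (sum δ)
        | ℤ.pos-+ (sum L) (sum δ) | ℤ.pos-+ x (sum p) =
  regroup (+ l) (+ e) (+ x) (+ sum L) (+ sum δ) (+ sum p)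
  where
  regroup : ∀ l e x L δ p →
            ((l ℤ.+ e) ℤ.- x) ℤ.+ ((L ℤ.+ δ) ℤ.- p) ≡ ((l ℤ.+ L) ℤ.+ (e ℤ.+ δ)) ℤ.- (x ℤ.+ p)
  regroup = solve-∀

sumℤ-weight-↭ : ∀ L δ p → length L ≡ length δ → p ↭ δ → sumℤ (weight L δ p) ≡ + sum L
sumℤ-weight-↭ L δ p eq p↭δ = begin
  sumℤ (weight L δ p)              ≡⟨ sumℤ-weight L δ p eq (sym (↭-length p↭δ)) ⟩
  + (sum L + sum δ) ℤ.- + sum p    ≡⟨ cong (λ s → + (sum L + sum δ) ℤ.- + s) (sum-↭ p↭δ) ⟩
  + (sum L + sum δ) ℤ.- + sum δ    ≡⟨ ℤ.m-n≡m⊖n (sum L + sum δ) (sum δ) ⟩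
  (sum L + sum δ) ℤ.⊖ sum δ        ≡⟨ ℤ.⊖-≥ (m≤n+m (sum δ) (sum L)) ⟩
  + (sum L + sum δ ∸ sum δ)        ≡⟨ cong +_ (m+n∸n≡m (sum L) (sum δ)) ⟩
  + sum L                          ∎
  where open ≡-Reasoning

alternantSum-dropFirst : ∀ m d n L δ → length L ≡ suc m → length δ ≡ suc m → sum L ≡ d * n →
  alternantSum (weightMult (suc m) d n) L δ ≡ alternantSum (λ w → multisetCount (monomialsUpTo m n) d (drop 1 w)) L δ
alternantSum-dropFirst m d n L δ lL lδ total =
  alternantSum-cong {weightMult (suc m) d n} {λ w → multisetCount (monomialsUpTo m n) d (drop 1 w)} L δ λ {p} p↭δ →
  weightMult-suc m d n (weight L δ p)
    (trans (length-weight L δ p (trans lL (sym lδ)) (sym (↭-length p↭δ))) (trans (↭-length p↭δ) lδ))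
    (trans (sumℤ-weight-↭ L δ p (trans lL (sym lδ)) p↭δ) (cong +_ total))

alternantSum-truncate : ∀ m n d D a L e δ → length L ≡ m → length δ ≡ m → sum L + sum δ ≤ D →
  alternantSum (λ w → multisetCount (monomialsUpTo m n) d (drop 1 w)) (a ∷ L) (e ∷ δ) ≡
  alternantSum (λ w → multisetCountPruned (monomialsUpTo m (n ⊓ D)) (d ⊓ D) (drop 1 w)) (a ∷ L) (e ∷ δ)
alternantSum-truncate m n d D a L e δ lL lδ bound =
  alternantSum-cong {λ w → multisetCount (monomialsUpTo m n) d (drop 1 w)}
                    {λ w → multisetCountPruned (monomialsUpTo m (n ⊓ D)) (d ⊓ D) (drop 1 w)} (a ∷ L) (e ∷ δ) term
  where
  term : ∀ {p} → p ↭ e ∷ δ →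
         multisetCount (monomialsUpTo m n) d (drop 1 (weight (a ∷ L) (e ∷ δ) p)) ≡
         multisetCountPruned (monomialsUpTo m (n ⊓ D)) (d ⊓ D) (drop 1 (weight (a ∷ L) (e ∷ δ) p))
  term {[]} p↭ with () ← ↭-length p↭
  term {x ∷ p} p↭ =
    trans (multisetCount-monomialsUpTo-⊓ m n d D β lβ β≤D)
          (multisetCount≡multisetCountPruned _ (d ⊓ D) β
            (subst (λ l → OfLength l (monomialsUpTo m (n ⊓ D))) (sym lβ) (monomialsUpTo-length m (n ⊓ D))))
    where
    β : List ℤ
    β = weight L δ p
    lδp : length δ ≡ length p
    lδp = sym (suc-injective (↭-length p↭))
    lβ : length β ≡ m
    lβ = trans (length-weight L δ p (trans lL (sym lδ)) lδp) (trans (sym lδp) lδ)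
    β≤D : sumℤ β ℤ.≤ + D
    β≤D = begin
      sumℤ β                             ≡⟨ sumℤ-weight L δ p (trans lL (sym lδ)) lδp ⟩
      + (sum L + sum δ) ℤ.- + sum p      ≤⟨ ℤ.i-j≤i _ (+ sum p) ⟩
      + (sum L + sum δ)                  ≤⟨ ℤ.+≤+ bound ⟩
      + D                                ∎
      where open ℤ.≤-Reasoning

-- Appending a zero part

monomialsSplitLast : ℕ → ℕ → List (List ℕ × ℕ)
monomialsSplitLast zero n = ([] , n) ∷ []
monomialsSplitLast (suc m) n = concatMap (λ k → map (Product.map₁ (k ∷_)) (monomialsSplitLast m (n ∸ k))) (upTo (suc n))

joinLast : List ℕ × ℕ → List ℕ
joinLast (u , e) = u ∷ʳ e

monomials-one : ∀ n → monomials 1 n ≡ (n ∷ []) ∷ []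
monomials-one n = trans (cong concat (List.map-upTo _ (suc n))) (only-last id n)
  where
  only-last : ∀ (h : ℕ → ℕ) n →
              concat (applyUpTo (λ k → map (h k ∷_) (monomials 0 (n ∸ k))) (suc n)) ≡ (h n ∷ []) ∷ []
  only-last h zero = refl
  only-last h (suc n) = only-last (h ∘ suc) n

monomials-suc-splitLast : ∀ m n → monomials (suc m) n ≡ map joinLast (monomialsSplitLast m n)
monomials-suc-splitLast zero n = monomials-one n
monomials-suc-splitLast (suc m) n =
  trans (List.concatMap-cong (λ k → trans (cong (map (k ∷_)) (monomials-suc-splitLast m (n ∸ k)))
                                          (trans (sym (List.map-∘ (monomialsSplitLast m (n ∸ k))))
                                                 (List.map-∘ (monomialsSplitLast m (n ∸ k)))))
                             (upTo (suc n)))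
        (sym (List.map-concatMap joinLast (λ k → map (Product.map₁ (k ∷_)) (monomialsSplitLast m (n ∸ k)))
                                          (upTo (suc n))))

monomialsSplitLast-length : ∀ m n → All (λ (u , _) → length u ≡ m) (monomialsSplitLast m n)
monomialsSplitLast-length zero n = refl ∷ []
monomialsSplitLast-length (suc m) n =
  All.concat⁺ (All.map⁺ (All.applyUpTo⁺₁ id (suc n) λ {k} _ →
    All.map⁺ (All.map (cong suc) (monomialsSplitLast-length m (n ∸ k)))))

keepLastZero : List (List ℕ × ℕ) → List (List ℕ)
keepLastZero [] = []
keepLastZero ((u , zero) ∷ L) = u ∷ keepLastZero L
keepLastZero ((u , suc _) ∷ L) = keepLastZero L

keepLastZero-++ : ∀ L M → keepLastZero (L ++ M) ≡ keepLastZero L ++ keepLastZero M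
keepLastZero-++ [] M = refl
keepLastZero-++ ((u , zero) ∷ L) M = cong (u ∷_) (keepLastZero-++ L M)
keepLastZero-++ ((u , suc _) ∷ L) M = keepLastZero-++ L M

keepLastZero-concat : ∀ Ls → keepLastZero (concat Ls) ≡ concat (map keepLastZero Ls)
keepLastZero-concat [] = refl
keepLastZero-concat (L ∷ Ls) = trans (keepLastZero-++ L (concat Ls)) (cong (keepLastZero L ++_) (keepLastZero-concat Ls))

keepLastZero-map-∷ : ∀ k L → keepLastZero (map (Product.map₁ (k ∷_)) L) ≡ map (k ∷_) (keepLastZero L)
keepLastZero-map-∷ k [] = refl
keepLastZero-map-∷ k ((u , zero) ∷ L) = cong ((k ∷ u) ∷_) (keepLastZero-map-∷ k L)
keepLastZero-map-∷ k ((u , suc _) ∷ L) = keepLastZero-map-∷ k L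

keepLastZero-monomialsSplitLast : ∀ m n → keepLastZero (monomialsSplitLast m n) ≡ monomials m n
keepLastZero-monomialsSplitLast zero zero = refl
keepLastZero-monomialsSplitLast zero (suc n) = refl
keepLastZero-monomialsSplitLast (suc m) n =
  trans (keepLastZero-concat (map (λ k → map (Product.map₁ (k ∷_)) (monomialsSplitLast m (n ∸ k))) (upTo (suc n))))
        (cong concat (trans (sym (List.map-∘ (upTo (suc n))))
                            (List.map-cong (λ k → trans (keepLastZero-map-∷ k (monomialsSplitLast m (n ∸ k)))
                                                        (cong (map (k ∷_)) (keepLastZero-monomialsSplitLast m (n ∸ k))))
                                           (upTo (suc n)))))

isZeroVec-∷ʳ-zero : ∀ α → isZeroVec (α ∷ʳ + 0) ≡ isZeroVec α
isZeroVec-∷ʳ-zero [] = refl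
isZeroVec-∷ʳ-zero (a ∷ α) with a ℤ.≟ + 0
... | yes _ = isZeroVec-∷ʳ-zero α
... | no _ = refl

scaleSub-∷ʳ : ∀ k u e α z → length u ≡ length α →
              scaleSub k (u ∷ʳ e) (α ∷ʳ z) ≡ scaleSub k u α ∷ʳ (z ℤ.- + (k * e))
scaleSub-∷ʳ k [] e [] z _ = refl
scaleSub-∷ʳ k (x ∷ u) e (a ∷ α) z eq = cong (_ ∷_) (scaleSub-∷ʳ k u e α z (suc-injective eq))

HasNegative-∷ʳ : ∀ β {z} → z ℤ.< + 0 → HasNegative (β ∷ʳ z)
HasNegative-∷ʳ [] z<0 = here z<0
HasNegative-∷ʳ (x ∷ β) z<0 = there (HasNegative-∷ʳ β z<0)

multisetCount-∷ʳ-zero : ∀ L d α → All (λ (u , _) → length u ≡ length α) L →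
                        multisetCount (map joinLast L) d (α ∷ʳ + 0) ≡ multisetCount (keepLastZero L) d α
multisetCount-∷ʳ-zero [] zero α _ = cong (λ b → if b then 1 else 0) (isZeroVec-∷ʳ-zero α)
multisetCount-∷ʳ-zero [] (suc d) α _ = refl
multisetCount-∷ʳ-zero ((u , zero) ∷ L) d α (lu ∷ lL) = sum-upTo-cong (suc d) λ {k} _ →
  begin
    multisetCount (map joinLast L) (d ∸ k) (scaleSub k (u ∷ʳ 0) (α ∷ʳ + 0))
      ≡⟨ cong (multisetCount (map joinLast L) (d ∸ k)) (scaleSub-∷ʳ k u 0 α (+ 0) lu) ⟩
    multisetCount (map joinLast L) (d ∸ k) (scaleSub k u α ∷ʳ (+ 0 ℤ.- + (k * 0)))
      ≡⟨ cong (λ z → multisetCount (map joinLast L) (d ∸ k) (scaleSub k u α ∷ʳ (+ 0 ℤ.- + z))) (*-zeroʳ k) ⟩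
    multisetCount (map joinLast L) (d ∸ k) (scaleSub k u α ∷ʳ + 0)
      ≡⟨ multisetCount-∷ʳ-zero L (d ∸ k) (scaleSub k u α)
           (subst (λ l → All (λ (u , _) → length u ≡ l) L) (sym (length-scaleSub k u α lu)) lL) ⟩
    multisetCount (keepLastZero L) (d ∸ k) (scaleSub k u α) ∎
  where open ≡-Reasoning
multisetCount-∷ʳ-zero ((u , suc e) ∷ L) d α (lu ∷ lL) =
  trans (multisetCount-unusable (trans (length-∷ʳ u (suc e)) (trans (cong suc lu) (sym (length-∷ʳ α (+ 0)))) , unusable)
                                lengths)
        (multisetCount-∷ʳ-zero L d α lL)
  where
  lengths : OfLength (length (α ∷ʳ + 0)) (map joinLast L)
  lengths = All.map⁺ (All.map (λ {(v , f)} lv → trans (length-∷ʳ v f) (trans (cong suc lv) (sym (length-∷ʳ α (+ 0)))))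
                              lL)
  unusable : ∀ k → HasNegative (scaleSub (suc k) (u ∷ʳ suc e) (α ∷ʳ + 0))
  unusable k rewrite scaleSub-∷ʳ (suc k) u (suc e) α (+ 0) lu = HasNegative-∷ʳ _ ℤ.-<+

weightMult-∷ʳ-zero : ∀ m d n α → length α ≡ m → weightMult (suc m) d n (α ∷ʳ + 0) ≡ weightMult m d n α
weightMult-∷ʳ-zero m d n α lα = begin
  multisetCount (monomials (suc m) n) d (α ∷ʳ + 0)
    ≡⟨ cong (λ L → multisetCount L d (α ∷ʳ + 0)) (monomials-suc-splitLast m n) ⟩
  multisetCount (map joinLast (monomialsSplitLast m n)) d (α ∷ʳ + 0)
    ≡⟨ multisetCount-∷ʳ-zero (monomialsSplitLast m n) d α
         (subst (λ l → All (λ (u , _) → length u ≡ l) (monomialsSplitLast m n)) (sym lα)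
                (monomialsSplitLast-length m n)) ⟩
  multisetCount (keepLastZero (monomialsSplitLast m n)) d α
    ≡⟨ cong (λ L → multisetCount L d α) (keepLastZero-monomialsSplitLast m n) ⟩
  multisetCount (monomials m n) d α ∎
  where open ≡-Reasoning

weight-∷ʳ : ∀ L δ p l e x → length L ≡ length δ → length δ ≡ length p →
            weight (L ∷ʳ l) (δ ∷ʳ e) (p ∷ʳ x) ≡ weight L δ p ∷ʳ (+ (l + e) ℤ.- + x)
weight-∷ʳ L δ p l e x eq eq′ = begin
  zipWith _ (zipWith _ (L ∷ʳ l) (δ ∷ʳ e)) (p ∷ʳ x)
    ≡⟨ cong (λ w → zipWith _ w (p ∷ʳ x)) (zipWith-∷ʳ _ L δ l e eq) ⟩
  zipWith _ (zipWith _ L δ ∷ʳ + (l + e)) (p ∷ʳ x)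
    ≡⟨ zipWith-∷ʳ _ (zipWith _ L δ) p (+ (l + e)) x lengths ⟩
  weight L δ p ∷ʳ (+ (l + e) ℤ.- + x) ∎
  where
  open ≡-Reasoning
  lengths : length (zipWith (λ l e → + (l + e)) L δ) ≡ length p
  lengths = trans (List.length-zipWith _ L δ) (trans (cong (_⊓ length δ) eq) (trans (⊓-idem (length δ)) eq′))

weight-map-suc : ∀ L δ q → weight L (map suc δ) (map suc q) ≡ weight L δ q
weight-map-suc [] δ q = refl
weight-map-suc (l ∷ L) [] q = refl
weight-map-suc (l ∷ L) (e ∷ δ) [] = refl
weight-map-suc (l ∷ L) (e ∷ δ) (x ∷ q) = cong₂ _∷_ entry (weight-map-suc L δ q)
  where
  entry : + (l + suc e) ℤ.- + suc x ≡ + (l + e) ℤ.- + x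
  entry rewrite +-suc l e = trans (ℤ.m-n≡m⊖n (suc (l + e)) (suc x))
                              (trans (ℤ.[1+m]⊖[1+n]≡m⊖n (l + e) x) (sym (ℤ.m-n≡m⊖n (l + e) x)))

ascents-∷ʳ-zero : ∀ xs → ascents (xs ∷ʳ 0) ≡ ascents xs
ascents-∷ʳ-zero [] = refl
ascents-∷ʳ-zero (x ∷ xs) = cong₂ _+_ no-new-ascent (ascents-∷ʳ-zero xs)
  where
  no-new-ascent : sum (map (λ y → if x <ᵇ y then 1 else 0) (xs ∷ʳ 0)) ≡
                  sum (map (λ y → if x <ᵇ y then 1 else 0) xs)
  no-new-ascent = trans (cong sum (List.map-++ _ xs (0 ∷ [])))
                        (trans (sum-++ (map _ xs) (0 ∷ [])) (+-identityʳ _))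

ascents-map-suc : ∀ xs → ascents (map suc xs) ≡ ascents xs
ascents-map-suc [] = refl
ascents-map-suc (x ∷ xs) = cong₂ _+_ (cong sum (sym (List.map-∘ xs))) (ascents-map-suc xs)

sign-map-suc-∷ʳ-zero : ∀ q → sign (map suc q ∷ʳ 0) ≡ sign q
sign-map-suc-∷ʳ-zero q = cong parity (trans (ascents-∷ʳ-zero (map suc q)) (ascents-map-suc q))

weightMult-∷ʳ-nonzero : ∀ m d n L δ q {y} → length L ≡ m → length δ ≡ m → length q ≡ m → y ≢ 0 →
                        weightMult (suc m) d n (weight (L ∷ʳ 0) (δ ∷ʳ 0) (q ∷ʳ y)) ≡ 0
weightMult-∷ʳ-nonzero m d n L δ q {y} lL lδ lq y≢0
  rewrite weight-∷ʳ L δ q 0 0 y (trans lL (sym lδ)) (trans lδ (sym lq)) =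
  multisetCount-HasNegative (monomials (suc m) n) d _ (subst (λ l → OfLength l _) (sym lw) (monomials-length (suc m) n))
    (HasNegative-∷ʳ w (negative y≢0))
  where
  w : List ℤ
  w = weight L δ q
  lw : length (w ∷ʳ (+ 0 ℤ.- + y)) ≡ suc m
  lw = trans (length-∷ʳ w _) (cong suc (trans (length-weight L δ q (trans lL (sym lδ)) (trans lδ (sym lq))) lq))
  negative : ∀ {y} → y ≢ 0 → + 0 ℤ.- + y ℤ.< + 0
  negative {zero} y≢0 = ⊥-elim (y≢0 refl)
  negative {suc _} _ = ℤ.-<+

weightMult-map-suc-∷ʳ-zero : ∀ m d n L δ q → length L ≡ m → length δ ≡ m → length q ≡ m →
  weightMult (suc m) d n (weight (L ∷ʳ 0) (map suc δ ∷ʳ 0) (map suc q ∷ʳ 0)) ≡ weightMult m d n (weight L δ q)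
weightMult-map-suc-∷ʳ-zero m d n L δ q lL lδ lq = begin
  weightMult (suc m) d n (weight (L ∷ʳ 0) (map suc δ ∷ʳ 0) (map suc q ∷ʳ 0))
    ≡⟨ cong (weightMult (suc m) d n) (weight-∷ʳ L (map suc δ) (map suc q) 0 0 0 lLδ lδq) ⟩
  weightMult (suc m) d n (weight L (map suc δ) (map suc q) ∷ʳ + 0)
    ≡⟨ cong (λ w → weightMult (suc m) d n (w ∷ʳ + 0)) (weight-map-suc L δ q) ⟩
  weightMult (suc m) d n (weight L δ q ∷ʳ + 0)
    ≡⟨ weightMult-∷ʳ-zero m d n (weight L δ q) (trans (length-weight L δ q (trans lL (sym lδ)) (trans lδ (sym lq))) lq) ⟩
  weightMult m d n (weight L δ q) ∎
  where
  open ≡-Reasoning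
  lLδ : length L ≡ length (map suc δ)
  lLδ = trans lL (sym (trans (List.length-map suc δ) lδ))
  lδq : length (map suc δ) ≡ length (map suc q)
  lδq = trans (List.length-map suc δ) (trans (trans lδ (sym lq)) (sym (List.length-map suc q)))

alternantSum-∷ʳ-zero : ∀ m d n L δ → length L ≡ m → length δ ≡ m →
  alternantSum (weightMult (suc m) d n) (L ∷ʳ 0) (map suc δ ∷ʳ 0) ≡ alternantSum (weightMult m d n) L δ
alternantSum-∷ʳ-zero m d n L δ lL lδ = begin
  sumℤ (map F (permutations (map suc δ ∷ʳ 0)))
    ≡⟨ sumℤ-permutations-∷ʳ F (map suc δ) (All.map⁺ (All.universal (λ _ ()) δ)) F-vanishes ⟩
  sumℤ (map (λ q → F (q ∷ʳ 0)) (permutations (map suc δ)))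
    ≡⟨ cong (λ P → sumℤ (map (λ q → F (q ∷ʳ 0)) P)) (permutations-map suc δ) ⟩
  sumℤ (map (λ q → F (q ∷ʳ 0)) (map (map suc) (permutations δ)))
    ≡⟨ cong sumℤ (sym (List.map-∘ (permutations δ))) ⟩
  sumℤ (map (λ q → F (map suc q ∷ʳ 0)) (permutations δ))
    ≡⟨ cong sumℤ (List.map-cong-local (All.map term (permutations-↭ δ))) ⟩
  alternantSum (weightMult m d n) L δ ∎
  where
  open ≡-Reasoning
  F : List ℕ → ℤ
  F p = sign p ℤ.* + weightMult (suc m) d n (weight (L ∷ʳ 0) (map suc δ ∷ʳ 0) p)
  F-vanishes : ∀ q y → length q ≡ length (map suc δ) → y ≢ 0 → F (q ∷ʳ y) ≡ + 0
  F-vanishes q y lq y≢0 =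
    trans (cong (λ c → sign (q ∷ʳ y) ℤ.* + c)
                (weightMult-∷ʳ-nonzero m d n L (map suc δ) q lL (trans (List.length-map suc δ) lδ)
                                       (trans lq (trans (List.length-map suc δ) lδ)) y≢0))
          (ℤ.*-zeroʳ (sign (q ∷ʳ y)))
  term : ∀ {q} → q ↭ δ → F (map suc q ∷ʳ 0) ≡ sign q ℤ.* + weightMult m d n (weight L δ q)
  term {q} q↭δ = cong₂ (λ s c → s ℤ.* + c) (sign-map-suc-∷ʳ-zero q)
                       (weightMult-map-suc-∷ʳ-zero m d n L δ q lL lδ (trans (↭-length q↭δ) lδ))

plethysmCoeffᴸ : ℕ → ℕ → List ℕ → ℤ
plethysmCoeffᴸ d n L = alternantSum (weightMult (length L) d n) L (delta (length L))

plethysmCoeff-toList : ∀ {m} d n (λ' : Vec ℕ m) → plethysmCoeff m d n λ' ≡ plethysmCoeffᴸ d n (toList λ')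
plethysmCoeff-toList d n λ' =
  cong (λ k → alternantSum (weightMult k d n) (toList λ') (delta k)) (sym (Vec.length-toList λ'))

delta-suc : ∀ m → delta (suc m) ≡ map suc (delta m) ∷ʳ 0
delta-suc m = trans (cong reverse (cong (0 ∷_) (sym (List.map-upTo suc m))))
                    (trans (List.unfold-reverse 0 (map suc (upTo m)))
                           (cong (_∷ʳ 0) (sym (List.reverse-map suc (upTo m)))))

length-delta : ∀ m → length (delta m) ≡ m
length-delta m = trans (List.length-reverse (upTo m)) (List.length-upTo m)

plethysmCoeffᴸ-∷ʳ-zero : ∀ d n L → plethysmCoeffᴸ d n (L ∷ʳ 0) ≡ plethysmCoeffᴸ d n L
plethysmCoeffᴸ-∷ʳ-zero d n L = begin
  alternantSum (weightMult (length (L ∷ʳ 0)) d n) (L ∷ʳ 0) (delta (length (L ∷ʳ 0)))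
    ≡⟨ cong (λ k → alternantSum (weightMult k d n) (L ∷ʳ 0) (delta k)) (length-∷ʳ L 0) ⟩
  alternantSum (weightMult (suc (length L)) d n) (L ∷ʳ 0) (delta (suc (length L)))
    ≡⟨ cong (alternantSum (weightMult (suc (length L)) d n) (L ∷ʳ 0)) (delta-suc (length L)) ⟩
  alternantSum (weightMult (suc (length L)) d n) (L ∷ʳ 0) (map suc (delta (length L)) ∷ʳ 0)
    ≡⟨ alternantSum-∷ʳ-zero (length L) d n L (delta (length L)) refl (length-delta (length L)) ⟩
  alternantSum (weightMult (length L) d n) L (delta (length L)) ∎
  where open ≡-Reasoning

plethysmCoeffᴸ-++-replicate : ∀ d n k L → plethysmCoeffᴸ d n (L ++ replicate k 0) ≡ plethysmCoeffᴸ d n L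
plethysmCoeffᴸ-++-replicate d n zero L = cong (plethysmCoeffᴸ d n) (List.++-identityʳ L)
plethysmCoeffᴸ-++-replicate d n (suc k) L =
  trans (cong (plethysmCoeffᴸ d n) (sym (List.++-assoc L (0 ∷ []) (replicate k 0))))
        (trans (plethysmCoeffᴸ-++-replicate d n k (L ∷ʳ 0)) (plethysmCoeffᴸ-∷ʳ-zero d n L))

dropTrailingZeros-padding : ∀ xs → Σ ℕ λ k → dropTrailingZeros xs ++ replicate k 0 ≡ xs
dropTrailingZeros-padding [] = 0 , refl
dropTrailingZeros-padding (zero ∷ xs) with dropTrailingZeros xs | dropTrailingZeros-padding xs
... | [] | k , eq = suc k , cong (0 ∷_) eq
... | y ∷ ys | k , eq = k , cong (0 ∷_) eq
dropTrailingZeros-padding (suc x ∷ xs) with dropTrailingZeros xs | dropTrailingZeros-padding xs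
... | [] | k , eq = k , cong (suc x ∷_) eq
... | y ∷ ys | k , eq = k , cong (suc x ∷_) eq

-- Three rows

m≤n*o⇒m≤[n⊓m]*[o⊓m] : ∀ {K d n} → K ≤ d * n → K ≤ (d ⊓ K) * (n ⊓ K)
m≤n*o⇒m≤[n⊓m]*[o⊓m] {zero} _ = z≤n
m≤n*o⇒m≤[n⊓m]*[o⊓m] {suc K} {zero} ()
m≤n*o⇒m≤[n⊓m]*[o⊓m] {suc K} {suc d} {zero} K≤dn with () ← subst (suc K ≤_) (*-zeroʳ d) K≤dn
m≤n*o⇒m≤[n⊓m]*[o⊓m] {K@(suc _)} {d@(suc _)} {n@(suc _)} K≤dn with ≤-total K d | ≤-total K n
... | inj₁ K≤d | _ = subst (λ x → K ≤ x * (n ⊓ K)) (sym (m≥n⇒m⊓n≡n K≤d)) (m≤m*n K (n ⊓ K))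
... | inj₂ d≤K | inj₁ K≤n =
  subst₂ (λ x y → K ≤ x * y) (sym (m≤n⇒m⊓n≡m d≤K)) (sym (m≥n⇒m⊓n≡n K≤n)) (m≤n*m K d)
... | inj₂ d≤K | inj₂ n≤K =
  subst₂ (λ x y → K ≤ x * y) (sym (m≤n⇒m⊓n≡m d≤K)) (sym (m≤n⇒m⊓n≡m n≤K)) K≤dn

reducedCoeff : ℕ → ℕ → ℕ → ℕ → ℕ → ℤ
reducedCoeff a b c d n =
  alternantSum (λ w → multisetCountPruned (monomialsUpTo 2 n) d (drop 1 w)) (a ∷ b ∷ c ∷ []) (delta 3)

ReducedVanishes : ℕ → ℕ → ℕ → Set
ReducedVanishes a b c = ∀ {d} → d < suc K → ∀ {n} → n < suc K → K ≤ d * n → reducedCoeff a b c d n ≡ + 0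
  where K = b + (b + c)

-- lemma6 runs this decision with a variable: reducedCoeff a b c d n evaluates without inspecting a,
-- since drop 1 discards the only weight entry that mentions it.
reducedVanishes? : ∀ a b c → Dec (ReducedVanishes a b c)
reducedVanishes? a b c =
  allUpTo? (λ d → allUpTo? (λ n → (_ ≤? d * n) →-dec (reducedCoeff a b c d n ℤ.≟ + 0)) _) _

plethysmCoeffᴸ-three-rows≡0 : ∀ {a b c d n} → ReducedVanishes a b c → 1 ≤ b → b ≤ a →
                              a + (b + (c + 0)) ≡ d * n →
                              plethysmCoeffᴸ d n (a ∷ b ∷ c ∷ []) ≡ + 0
plethysmCoeffᴸ-three-rows≡0 {a} {b} {c} {d} {n} vanishes 1≤b b≤a total = begin
  alternantSum (weightMult 3 d n) (a ∷ b ∷ c ∷ []) (delta 3)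
    ≡⟨ alternantSum-dropFirst 2 d n (a ∷ b ∷ c ∷ []) (delta 3) refl refl total ⟩
  alternantSum (λ w → multisetCount (monomialsUpTo 2 n) d (drop 1 w)) (a ∷ b ∷ c ∷ []) (delta 3)
    ≡⟨ alternantSum-truncate 2 n d K a (b ∷ c ∷ []) 2 (1 ∷ 0 ∷ []) refl refl tail≤K ⟩
  reducedCoeff a b c (d ⊓ K) (n ⊓ K)
    ≡⟨ vanishes (s≤s (m⊓n≤n d K)) {n ⊓ K} (s≤s (m⊓n≤n n K))
                (m≤n*o⇒m≤[n⊓m]*[o⊓m] {K} {d} {n} K≤dn) ⟩
  + 0 ∎
  where
  open ≡-Reasoning
  K : ℕ
  K = b + (b + c)
  tail≤K : b + (c + 0) + (1 + (0 + 0)) ≤ K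
  tail≤K rewrite +-identityʳ c | +-comm (b + c) 1 = +-monoˡ-≤ (b + c) 1≤b
  K≤dn : K ≤ d * n
  K≤dn = subst (K ≤_) (trans (cong (λ t → a + (b + t)) (sym (+-identityʳ c))) total) (+-monoˡ-≤ (b + c) b≤a)

bar-shape⇒plethysmCoeff≡0 : ∀ {m d n b c cs} (λ' : Vec ℕ m) → .{{NonZero b}} → IsPartition (d * n) λ' →
                            ∀ j → cs ++ replicate j 0 ≡ c ∷ [] → bar λ' ≡ b ∷ cs →
                            (∀ a → ReducedVanishes a b c) → plethysmCoeff m d n λ' ≡ + 0
bar-shape⇒plethysmCoeff≡0 {d = d} {n} {b} {c} {cs} (a ∷ rest) (decreasing , total) j padded bar≡ vanishes =
  begin
  plethysmCoeff _ d n (a ∷ rest)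
    ≡⟨ plethysmCoeff-toList d n (a ∷ rest) ⟩
  plethysmCoeffᴸ d n (a ∷ toList rest)
    ≡⟨ cong (λ xs → plethysmCoeffᴸ d n (a ∷ xs)) rest≡ ⟨
  plethysmCoeffᴸ d n ((a ∷ b ∷ cs) ++ replicate k 0)
    ≡⟨ plethysmCoeffᴸ-++-replicate d n k (a ∷ b ∷ cs) ⟩
  plethysmCoeffᴸ d n (a ∷ b ∷ cs)
    ≡⟨ plethysmCoeffᴸ-++-replicate d n j (a ∷ b ∷ cs) ⟨
  plethysmCoeffᴸ d n (a ∷ b ∷ cs ++ replicate j 0)
    ≡⟨ cong (λ xs → plethysmCoeffᴸ d n (a ∷ b ∷ xs)) padded ⟩
  plethysmCoeffᴸ d n (a ∷ b ∷ c ∷ [])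
    ≡⟨ plethysmCoeffᴸ-three-rows≡0 {d = d} {n} (vanishes a) (>-nonZero⁻¹ b) b≤a total′ ⟩
  + 0 ∎
  where
  open ≡-Reasoning
  k : ℕ
  k = proj₁ (dropTrailingZeros-padding (toList rest))
  rest≡ : (b ∷ cs) ++ replicate k 0 ≡ toList rest
  rest≡ = subst (λ ys → ys ++ replicate k 0 ≡ toList rest) bar≡ (proj₂ (dropTrailingZeros-padding (toList rest)))
  b≤a : b ≤ a
  b≤a = Linked.head (subst (λ xs → Linked _≥_ (a ∷ xs)) (sym rest≡) decreasing)
  total′ : a + (b + (c + 0)) ≡ d * n
  total′ = begin
    a + (b + (c + 0))                          ≡⟨ cong (λ xs → a + (b + sum xs)) padded ⟨
    a + (b + sum (cs ++ replicate j 0))        ≡⟨ cong (λ s → a + (b + s)) (sum-++-replicate-zero cs j) ⟩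
    a + (b + sum cs)                           ≡⟨ cong (λ s → a + (b + s)) (sum-++-replicate-zero cs k) ⟨
    a + sum ((b ∷ cs) ++ replicate k 0)        ≡⟨ cong (λ xs → a + sum xs) rest≡ ⟩
    a + sum (toList rest)                      ≡⟨ total ⟩
    d * n                                      ∎

lemma6 : (m d n : ℕ) (λ' : Vec ℕ m) → IsPartition (d * n) λ' →
           (bar λ' ≡ 3 ∷ 3 ∷ [] ⊎ bar λ' ≡ 3 ∷ 1 ∷ [] ⊎ bar λ' ≡ 2 ∷ 1 ∷ []
             ⊎ bar λ' ≡ 1 ∷ 1 ∷ [] ⊎ bar λ' ≡ 1 ∷ []) →
           plethysmCoeff m d n λ' ≡ + 0
lemma6 m d n λ' partition (inj₁ bar≡) =
  bar-shape⇒plethysmCoeff≡0 λ' partition 0 refl bar≡ (λ a → from-yes (reducedVanishes? a 3 3))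
lemma6 m d n λ' partition (inj₂ (inj₁ bar≡)) =
  bar-shape⇒plethysmCoeff≡0 λ' partition 0 refl bar≡ (λ a → from-yes (reducedVanishes? a 3 1))
lemma6 m d n λ' partition (inj₂ (inj₂ (inj₁ bar≡))) =
  bar-shape⇒plethysmCoeff≡0 λ' partition 0 refl bar≡ (λ a → from-yes (reducedVanishes? a 2 1))
lemma6 m d n λ' partition (inj₂ (inj₂ (inj₂ (inj₁ bar≡)))) =
  bar-shape⇒plethysmCoeff≡0 λ' partition 0 refl bar≡ (λ a → from-yes (reducedVanishes? a 1 1))
lemma6 m d n λ' partition (inj₂ (inj₂ (inj₂ (inj₂ bar≡)))) =
  bar-shape⇒plethysmCoeff≡0 λ' partition 1 refl bar≡ (λ a → from-yes (reducedVanishes? a 1 0))
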